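{- For every integer $n\ge 1$, $$\sum_{\pi\in PM_{2n}} q^{\mathrm{t}(\pi)} = q^{\binom{n+1}{2}}\,[2n-1]_q!!,$$ where $[2n-1]_q!!=\prod_{i=1}^{n}\frac{1-q^{2i-1}}{1-q}$.
   Context: A perfect matching on $[2n]=\{1,\dots,2n\}$ is a set partition of $[2n]$ all of whose blocks have size $2$; $PM_{2n}$ denotes the set of them. Each block $\{i<j\}$ is called an arc $(i,j)$; $\mathrm{Arcs}(\pi)$ is the set of the $n$ arcs of $\pi$. For a vertex $v\in[2n]$, $\mathrm{depth}(v)$ is the number of arcs $(i,j)$ of $\pi$ with $i<v<j$. For an arc $\alpha=(u,v)$, $\mathrm{depth}(\alpha)$ is the number of arcs $(i,j)$ of $\pi$ with $i<u<v<j$. The depth index of $\pi$ is $$\mathrm{t}(\pi)=\sum_{i=1}^{n}(2n-i)-\sum_{v=1}^{2n}\mathrm{depth}(v)+\sum_{\alpha\in\mathrm{Arcs}(\pi)}\mathrm{depth}(\alpha).$$ -}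

module Defs where

open import Level using (Level)
open import Data.Nat using (ℕ; zero; suc; _+_; _*_; _∸_; _<_; _<?_)
open import Data.Fin using (Fin; toℕ)
open import Data.Fin.Properties using (all?; _≟_)
open import Data.Vec using (Vec; []; _∷_; lookup)
open import Data.List using (List; []; _∷_; concatMap; map; filter; foldr; upTo; allFin)
open import Data.Nat.ListAction using (sum)
open import Data.Product using (_×_)
open import Relation.Binary.PropositionalEquality using (_≡_; _≢_)
open import Relation.Nullary using (Dec; ¬?)
open import Relation.Nullary.Decidable using (_×-dec_; ⌊_⌋)
open import Data.Bool using (Bool; if_then_else_)
open import Algebra.Bundles using (CommutativeSemiring)

allVecs : (k m : ℕ) → List (Vec (Fin k) m)
allVecs k zero    = [] ∷ []
allVecs k (suc m) = concatMap (λ x → map (x ∷_) (allVecs k m)) (allFin k)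

-- A perfect matching on the vertex set Fin m (vertices 0..m-1, i.e. [m] shifted
-- by one) is encoded as its partner map: a fixed-point-free involution.
IsPM : ∀ {m} → Vec (Fin m) m → Set
IsPM {m} v = (i : Fin m) → (lookup v (lookup v i) ≡ i) × (lookup v i ≢ i)

isPM? : ∀ {m} (v : Vec (Fin m) m) → Dec (IsPM v)
isPM? v = all? (λ i → (lookup v (lookup v i) ≟ i) ×-dec ¬? (lookup v i ≟ i))

PM : (n : ℕ) → List (Vec (Fin (2 * n)) (2 * n))
PM n = filter isPM? (allVecs (2 * n) (2 * n))

count : (m : ℕ) → (Fin m → Bool) → ℕ
count m p = sum (map (λ i → if p i then 1 else 0) (allFin m))

module _ {m : ℕ} (v : Vec (Fin m) m) where
  isLeft : Fin m → Bool
  isLeft i = ⌊ toℕ i <? toℕ (lookup v i) ⌋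

  depthV : Fin m → ℕ
  depthV w = count m (λ i → if isLeft i
                             then (if ⌊ toℕ i <? toℕ w ⌋ then ⌊ toℕ w <? toℕ (lookup v i) ⌋ else Bool.false)
                             else Bool.false)
    where import Data.Bool as Bool

  depthA : Fin m → ℕ
  depthA u = count m (λ i → if isLeft i
                             then (if ⌊ toℕ i <? toℕ u ⌋ then ⌊ toℕ (lookup v u) <? toℕ (lookup v i) ⌋ else Bool.false)
                             else Bool.false)
    where import Data.Bool as Bool

  sumDepthV : ℕ
  sumDepthV = sum (map depthV (allFin m))

  sumDepthA : ℕ
  sumDepthA = sum (map (λ u → if isLeft u then depthA u else 0) (allFin m))

S : ℕ → ℕ
S n = sum (map (λ i → 2 * n ∸ suc i) (upTo n))

-- depth index t(π) = S n - ∑ depth(v) + ∑ depth(α); computed as (S n + ∑depth(α)) ∸ ∑depth(v),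
-- which is exact since S n ≥ ∑ depth(v) for every perfect matching.
t : (n : ℕ) → Vec (Fin (2 * n)) (2 * n) → ℕ
t n v = (S n + sumDepthA v) ∸ sumDepthV v

module _ {c ℓ : Level} (R : CommutativeSemiring c ℓ) where
  open CommutativeSemiring R using (Carrier; rawSemiring; 0#; 1#) renaming (_+_ to _⊕_; _*_ to _⊗_)
  open import Algebra.Definitions.RawSemiring rawSemiring using (_^_)

  sumR : List Carrier → Carrier
  sumR = foldr _⊕_ 0#

  prodR : List Carrier → Carrier
  prodR = foldr _⊗_ 1#

  -- q-integer [m]_q = (1 - q^m)/(1 - q) = 1 + q + ... + q^{m-1}
  qInt : Carrier → ℕ → Carrier
  qInt q m = sumR (map (λ j → q ^ j) (upTo m))

  qDoubleFact : Carrier → ℕ → Carrier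
  qDoubleFact q n = prodR (map (λ i → qInt q (2 * suc i ∸ 1)) (upTo n))

  depthGF : Carrier → ℕ → Carrier
  depthGF q n = sumR (map (λ π → q ^ t n π) (PM n))

{-# OPTIONS --safe #-}
module Submission where

-- Read a matching from right to left, one vertex at a time: the new vertex either opens an
-- arc, whose partner is read later, or closes one of the h arcs currently open.  Closing the
-- arc whose open endpoint has k open endpoints to its right contributes q^k, so the h choices
-- contribute [h]_q.  Following the depth statistics through the two moves shows
-- t(π) = C(n+1,2) + e(π), where e gains 2c at each opening (c = number of arcs already closed)
-- and k at each closing.  Hence the generating function G(n,h,c) of partial matchings with
-- h open and c closed arcs satisfies G(n+1,h,c) = q^{2c} G(n,h-1,c) + [h+1]_q G(n,h+1,c-1),
-- which gives [h]_q! G(n,h,c) = [2c-1]_q!! [2c+1]_q ... [2c+h]_q; take h = 0 and c = n.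

open import Defs
open import Level using (Level)
open import Data.Nat using (ℕ; suc; _≥_)
open import Data.Nat.Combinatorics using (_C_)
open import Algebra.Bundles using (CommutativeSemiring)
open import Algebra.Definitions.RawSemiring using (_^_)

open import Algebra.Bundles using (Monoid)
import Algebra.Properties.Monoid.Sum
open import Data.Bool using (Bool; true; false; if_then_else_; _∧_; not) renaming (_≟_ to _≟ᵇ_)
import Data.Bool.Properties as BoolP
open import Data.Empty using (⊥-elim)
open import Data.Fin as Fin using (Fin; toℕ; punchOut)
open import Data.Fin.Permutation using (permutation)
import Data.Fin.Properties as FinP
open import Data.List as List using (List; []; _∷_; _++_; [_]; map; concatMap; filter; allFin)
open import Data.List.Membership.Propositional using (_∈_; find; lose)
import Data.List.Membership.Propositional.Properties as ∈P
open import Data.List.Membership.Propositional.Properties.WithK using (unique∧set⇒bag)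
import Data.List.Properties as ListP
open import Data.List.Relation.Binary.BagAndSetEquality using (∼bag⇒↭)
open import Data.List.Relation.Binary.Disjoint.Propositional using (Disjoint)
open import Data.List.Relation.Binary.Permutation.Propositional as ↭ using (_↭_)
import Data.List.Relation.Binary.Permutation.Propositional.Properties as ↭P
import Data.List.Relation.Binary.Permutation.Setoid.Properties as PermutationSetoidP
import Data.List.Relation.Unary.All as All
import Data.List.Relation.Unary.All.Properties as AllP
import Data.List.Relation.Unary.AllPairs as AllPairs
import Data.List.Relation.Unary.AllPairs.Properties as AllPairsP
open import Data.List.Relation.Unary.Any using (here; there)
open import Data.List.Relation.Unary.Unique.Propositional using (Unique)
import Data.List.Relation.Unary.Unique.Propositional.Properties as UniqueP
open import Data.Nat as ℕ using (zero; _+_; _*_; _∸_; _≤_; _<ᵇ_; _≡ᵇ_; z≤n; s≤s)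
open import Data.Nat.Combinatorics using (nCk+nC[k+1]≡[n+1]C[k+1]; nC1≡n)
open import Data.Nat.ListAction using (sum)
import Data.Nat.ListAction.Properties as SumP
import Data.Nat.Properties as ℕP
open import Data.Nat.Tactic.RingSolver using (solve-∀)
open import Data.Product using (_×_; _,_; proj₁; proj₂; ∃; ∃₂)
open import Data.Sum using (_⊎_; inj₁; inj₂)
open import Data.Vec as Vec using (Vec; []; _∷_; lookup)
import Data.Vec.Properties as VecP
open import Function using (_∘_; id; Equivalence; case_of_)
open import Function.Bundles using (mk⇔)
open import Relation.Binary.PropositionalEquality using (_≡_; _≢_; refl; sym; trans; cong; cong₂; subst; module ≡-Reasoning)
open import Relation.Nullary using (yes; no; contradiction)
open import Relation.Nullary.Decidable using (⌊_⌋)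

open import Algebra.Properties.CommutativeMonoid.Sum ℕP.+-0-commutativeMonoid
  using (sum-syntax; sum-cong-≗; ∑-distrib-+; ∑-permute; sum-replicate-zero)

indicator : Bool → ℕ
indicator b = if b then 1 else 0

card : (n : ℕ) → (Fin n → Bool) → ℕ
card n p = ∑[ i < n ] indicator (p i)

infix 7 _<ᶠ_ _==ᶠ_

_<ᶠ_ : ∀ {n} → Fin n → Fin n → Bool
i <ᶠ j = toℕ i <ᵇ toℕ j

_==ᶠ_ : ∀ {n} → Fin n → Fin n → Bool
i ==ᶠ j = toℕ i ≡ᵇ toℕ j

==ᶠ-refl : ∀ {n} (i : Fin n) → (i ==ᶠ i) ≡ true
==ᶠ-refl i = Equivalence.to BoolP.T-≡ (ℕP.≡⇒≡ᵇ (toℕ i) (toℕ i) refl)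

==ᶠ⇒≡ : ∀ {n} {i j : Fin n} → (i ==ᶠ j) ≡ true → i ≡ j
==ᶠ⇒≡ {i = i} {j} i==j = FinP.toℕ-injective (ℕP.≡ᵇ⇒≡ (toℕ i) (toℕ j) (Equivalence.from BoolP.T-≡ i==j))

≢⇒==ᶠ-false : ∀ {n} {i j : Fin n} → i ≢ j → (i ==ᶠ j) ≡ false
≢⇒==ᶠ-false {i = i} {j} i≢j with i ==ᶠ j in i==j
... | true  = ⊥-elim (i≢j (==ᶠ⇒≡ i==j))
... | false = refl

==ᶠ-sym : ∀ {n} (i j : Fin n) → (i ==ᶠ j) ≡ (j ==ᶠ i)
==ᶠ-sym i j = go (toℕ i) (toℕ j)
  where
  go : ∀ m n → (m ≡ᵇ n) ≡ (n ≡ᵇ m)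
  go zero    zero    = refl
  go zero    (suc n) = refl
  go (suc m) zero    = refl
  go (suc m) (suc n) = go m n

<ᶠ-irrefl : ∀ {n} (i : Fin n) → (i <ᶠ i) ≡ false
<ᶠ-irrefl i = go (toℕ i)
  where
  go : ∀ m → (m <ᵇ m) ≡ false
  go zero    = refl
  go (suc m) = go m

data Comparison {n} (i j : Fin n) : Set where
  less    : (i <ᶠ j) ≡ true  → (j <ᶠ i) ≡ false → (i ==ᶠ j) ≡ false → Comparison i j
  equal   : i ≡ j → Comparison i j
  greater : (i <ᶠ j) ≡ false → (j <ᶠ i) ≡ true  → (i ==ᶠ j) ≡ false → Comparison i j

compare : ∀ {n} (i j : Fin n) → Comparison i j
compare Fin.zero    Fin.zero    = equal refl
compare Fin.zero    (Fin.suc j) = less refl refl refl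
compare (Fin.suc i) Fin.zero    = greater refl refl refl
compare (Fin.suc i) (Fin.suc j) with compare i j
... | less i<j j≮i i≠j    = less i<j j≮i i≠j
... | equal refl          = equal refl
... | greater i≮j j<i i≠j = greater i≮j j<i i≠j

<ᶠ-asym : ∀ {n} (i j : Fin n) → (i <ᶠ j ∧ j <ᶠ i) ≡ false
<ᶠ-asym i j with compare i j
... | less _ j≮i _    = trans (cong (i <ᶠ j ∧_) j≮i) (BoolP.∧-zeroʳ (i <ᶠ j))
... | equal refl      = cong (_∧ (i <ᶠ i)) (<ᶠ-irrefl i)
... | greater i≮j _ _ = cong (_∧ (j <ᶠ i)) i≮j

<ᶠ⇒< : ∀ {n} (i j : Fin n) → (i <ᶠ j) ≡ true → toℕ i ℕ.< toℕ j
<ᶠ⇒< i j i<j = ℕP.<ᵇ⇒< (toℕ i) (toℕ j) (Equivalence.from BoolP.T-≡ i<j)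

<ᶠ-trans : ∀ {n} (i j k : Fin n) → (i <ᶠ j) ≡ true → (j <ᶠ k) ≡ true → (i <ᶠ k) ≡ true
<ᶠ-trans i j k i<j j<k = Equivalence.to BoolP.T-≡ (ℕP.<⇒<ᵇ (ℕP.<-trans (<ᶠ⇒< i j i<j) (<ᶠ⇒< j k j<k)))

∑-zero : ∀ n {f : Fin n → ℕ} → (∀ i → f i ≡ 0) → ∑[ i < n ] f i ≡ 0
∑-zero n f≗0 = trans (sum-cong-≗ f≗0) (sum-replicate-zero n)

∑-if-== : ∀ n (a : Fin n) (g : Fin n → ℕ) → ∑[ i < n ] (if i ==ᶠ a then g i else 0) ≡ g a
∑-if-== (suc n) Fin.zero    g = trans (cong (g Fin.zero +_) (∑-zero n (λ _ → refl))) (ℕP.+-identityʳ _)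
∑-if-== (suc n) (Fin.suc a) g = ∑-if-== n a (g ∘ Fin.suc)

card-cong : ∀ n {p p′ : Fin n → Bool} → (∀ i → p i ≡ p′ i) → card n p ≡ card n p′
card-cong n p≗p′ = sum-cong-≗ (cong indicator ∘ p≗p′)

card-split : ∀ n {p q r : Fin n → Bool} → (∀ i → indicator (p i) ≡ indicator (q i) + indicator (r i)) → card n p ≡ card n q + card n r
card-split n {q = q} {r} split = trans (sum-cong-≗ split) (∑-distrib-+ (indicator ∘ q) (indicator ∘ r))

card-< : ∀ n (a : Fin n) → card n (_<ᶠ a) ≡ toℕ a
card-< (suc n) Fin.zero    = ∑-zero n (λ _ → refl)
card-< (suc n) (Fin.suc a) = cong suc (card-< n a)

card-false : ∀ n {p : Fin n → Bool} → (∀ i → p i ≡ false) → card n p ≡ 0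
card-false n p≗false = ∑-zero n (cong indicator ∘ p≗false)

card≡0⇒false : ∀ n (p : Fin n → Bool) → card n p ≡ 0 → ∀ i → p i ≡ false
card≡0⇒false (suc n) p #p≡0 Fin.zero with p Fin.zero
... | false = refl
card≡0⇒false (suc n) p #p≡0 (Fin.suc i) =
  card≡0⇒false n (p ∘ Fin.suc) (ℕP.m+n≡0⇒n≡0 (indicator (p Fin.zero)) #p≡0) i

card≤ : ∀ n (p : Fin n → Bool) → card n p ≤ n
card≤ zero    p = z≤n
card≤ (suc n) p = ℕP.+-mono-≤ (indicator≤1 (p Fin.zero)) (card≤ n (p ∘ Fin.suc))
  where
  indicator≤1 : ∀ b → indicator b ≤ 1
  indicator≤1 false = z≤n
  indicator≤1 true  = s≤s z≤n

lookup-extensional : ∀ {A : Set} {m} {u u′ : Vec A m} → (∀ i → lookup u i ≡ lookup u′ i) → u ≡ u′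
lookup-extensional {u = u} {u′} u≗u′ = trans (sym (VecP.tabulate∘lookup u)) (trans (VecP.tabulate-cong u≗u′) (VecP.tabulate∘lookup u′))

map-injective : ∀ {A B : Set} {m} {f : A → B} → (∀ {x y} → f x ≡ f y → x ≡ y) →
  {u u′ : Vec A m} → Vec.map f u ≡ Vec.map f u′ → u ≡ u′
map-injective {f = f} f-inj {u} {u′} eq = lookup-extensional λ i →
  f-inj (trans (sym (VecP.lookup-map i f u)) (trans (cong (λ w → lookup w i) eq) (VecP.lookup-map i f u′)))

concatMap-unique : ∀ {A B K : Set} {k : A → K} {g : A → List B} →
  (∀ {x x′ y} → y ∈ g x → y ∈ g x′ → k x ≡ k x′) → (∀ x → Unique (g x)) →
  ∀ {xs} → Unique (map k xs) → Unique (concatMap g xs)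
concatMap-unique {k = k} {g} same-key g-unique keys-unique =
  UniqueP.concat⁺ (AllP.map⁺ (All.universal g-unique _)) (AllPairsP.map⁺ (AllPairs.map disjoint (AllPairsP.map⁻ keys-unique)))
  where
  disjoint : ∀ {x x′} → k x ≢ k x′ → Disjoint (g x) (g x′)
  disjoint kx≢kx′ (y∈ , y∈′) = kx≢kx′ (same-key y∈ y∈′)

unique-↭ : ∀ {A : Set} {xs ys : List A} → Unique xs → Unique ys →
  (∀ {x} → x ∈ xs → x ∈ ys) → (∀ {x} → x ∈ ys → x ∈ xs) → xs ↭ ys
unique-↭ xs! ys! xs⊆ys ys⊆xs = ∼bag⇒↭ (unique∧set⇒bag xs! ys! (mk⇔ xs⊆ys ys⊆xs))

module _ {a ℓ} (M : Monoid a ℓ) where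
  open Monoid M using (Carrier; _∙_; ε)
  private module MonoidSum = Algebra.Properties.Monoid.Sum M

  foldr-map-allFin : ∀ n (f : Fin n → Carrier) → List.foldr _∙_ ε (map f (allFin n)) ≡ MonoidSum.sum f
  foldr-map-allFin n f = trans (cong (List.foldr _∙_ ε) (ListP.map-tabulate id f)) (foldr-tabulate n f)
    where
    foldr-tabulate : ∀ n (f : Fin n → Carrier) → List.foldr _∙_ ε (List.tabulate f) ≡ MonoidSum.sum f
    foldr-tabulate zero    f = refl
    foldr-tabulate (suc n) f = cong (f Fin.zero ∙_) (foldr-tabulate n (f ∘ Fin.suc))

sum-allFin : ∀ n (f : Fin n → ℕ) → sum (map f (allFin n)) ≡ ∑[ i < n ] f i
sum-allFin = foldr-map-allFin ℕP.+-0-monoid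

⌊<?⌋≡<ᵇ : ∀ m n → ⌊ m ℕP.<? n ⌋ ≡ (m <ᵇ n)
⌊<?⌋≡<ᵇ m n with m ℕP.<? n
... | yes m<n = sym (Equivalence.to BoolP.T-≡ (ℕP.<⇒<ᵇ m<n))
... | no m≮n with m <ᵇ n in m<ᵇn
...   | true  = contradiction (ℕP.<ᵇ⇒< m n (Equivalence.from BoolP.T-≡ m<ᵇn)) m≮n
...   | false = refl

if-then-false : ∀ b b′ → (if b then b′ else false) ≡ b ∧ b′
if-then-false false b′ = refl
if-then-false true  b′ = refl

∧≡true⁻ : ∀ b b′ → b ∧ b′ ≡ true → b ≡ true × b′ ≡ true
∧≡true⁻ true true _ = refl , refl

-- A partial matching on Fin n is an involution P whose fixed points are the open vertices,
-- those whose partner has not been read yet; an arc (i , P i) is indexed by its left end i.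
module _ {n : ℕ} (P : Fin n → Fin n) where

  IsInvolution : Set
  IsInvolution = ∀ i → P (P i) ≡ i

  isOpen : Fin n → Bool
  isOpen f = P f ==ᶠ f

  isOpener : Fin n → Bool
  isOpener i = i <ᶠ P i

  vertexDepth : Fin n → ℕ
  vertexDepth w = card n (λ i → i <ᶠ w ∧ w <ᶠ P i)

  arcDepth : Fin n → ℕ
  arcDepth u = card n (λ i → i <ᶠ u ∧ (P u <ᶠ P i ∧ isOpener i))

  vertexDepthSum : ℕ
  vertexDepthSum = ∑[ w < n ] vertexDepth w

  arcDepthSum : ℕ
  arcDepthSum = ∑[ u < n ] (if isOpener u then arcDepth u else 0)

  openersBelow : Fin n → ℕ
  openersBelow f = card n (λ u → u <ᶠ f ∧ isOpener u)

  openDepthSum : ℕ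
  openDepthSum = ∑[ f < n ] (if isOpen f then openersBelow f else 0)

  openCount : ℕ
  openCount = card n isOpen

  openAbove : Fin n → ℕ
  openAbove a = card n (λ w → a <ᶠ w ∧ isOpen w)

-- κ c h = c(c - 1) + 2ch.  Balanced is the invariant kept along a history with c closed and
-- h open arcs; when no vertex is open it says t = C(n+1,2) + e (see t≡C2+exponent).
κ : ℕ → ℕ → ℕ
κ zero    h = 0
κ (suc c) h = κ c (suc h) + (h + h)

κ-suc : ∀ c h → κ c (suc h) ≡ κ c h + (c + c)
κ-suc zero    h = refl
κ-suc (suc c) h = trans (cong (_+ (suc h + suc h)) (κ-suc c (suc h))) (rearrange (κ c (suc h)) c h)
  where
  rearrange : ∀ k c h → k + (c + c) + (suc h + suc h) ≡ k + (h + h) + (suc c + suc c)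
  rearrange = solve-∀

Balanced : ∀ {n} (c h e : ℕ) → (Fin n → Fin n) → Set
Balanced c h e P = vertexDepthSum P + openDepthSum P + e ≡ arcDepthSum P + κ c h

record Valid {n} (h c e : ℕ) (P : Fin n → Fin n) : Set where
  constructor valid
  field
    involutive : IsInvolution P
    openCount≡ : openCount P ≡ h
    balanced   : Balanced c h e P

involution-injective : ∀ {n} {P : Fin n → Fin n} → IsInvolution P → ∀ {x y} → P x ≡ P y → x ≡ y
involution-injective {P = P} inv {x} {y} Px≡Py = trans (sym (inv x)) (trans (cong P Px≡Py) (inv y))

module Pointwise {n} {P P′ : Fin n → Fin n} (P≗P′ : ∀ i → P i ≡ P′ i) where

  isOpener-≗ : ∀ i → isOpener P i ≡ isOpener P′ i
  isOpener-≗ i = cong (i <ᶠ_) (P≗P′ i)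

  isOpen-≗ : ∀ i → isOpen P i ≡ isOpen P′ i
  isOpen-≗ i = cong (_==ᶠ i) (P≗P′ i)

  involution-≗ : IsInvolution P → IsInvolution P′
  involution-≗ inv i = trans (sym (P≗P′ (P′ i))) (trans (cong P (sym (P≗P′ i))) (inv i))

  vertexDepthSum-≗ : vertexDepthSum P ≡ vertexDepthSum P′
  vertexDepthSum-≗ = sum-cong-≗ λ w → card-cong n λ i → cong (λ x → i <ᶠ w ∧ w <ᶠ x) (P≗P′ i)

  arcDepthSum-≗ : arcDepthSum P ≡ arcDepthSum P′
  arcDepthSum-≗ = sum-cong-≗ λ u → cong₂ (λ b x → if b then x else 0) (isOpener-≗ u) (arcDepth-≗ u)
    where
    arcDepth-≗ : ∀ u → arcDepth P u ≡ arcDepth P′ u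
    arcDepth-≗ u = card-cong n λ i → cong₂ (λ x y → i <ᶠ u ∧ (x <ᶠ y ∧ i <ᶠ y)) (P≗P′ u) (P≗P′ i)

  openDepthSum-≗ : openDepthSum P ≡ openDepthSum P′
  openDepthSum-≗ = sum-cong-≗ λ f → cong₂ (λ b x → if b then x else 0) (isOpen-≗ f)
                     (card-cong n λ u → cong (u <ᶠ f ∧_) (isOpener-≗ u))

  openCount-≗ : openCount P ≡ openCount P′
  openCount-≗ = card-cong n isOpen-≗

  valid-≗ : ∀ {c h e} → Valid h c e P → Valid h c e P′
  valid-≗ {c} {h} {e} (valid inv #open bal) = valid (involution-≗ inv) (trans (sym openCount-≗) #open)
    (trans (cong₂ (λ x y → x + y + e) (sym vertexDepthSum-≗) (sym openDepthSum-≗)) (trans bal (cong (_+ κ c h) arcDepthSum-≗)))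

∑-involution : ∀ {n} {P : Fin n → Fin n} → IsInvolution P → (f : Fin n → ℕ) → ∑[ i < n ] f (P i) ≡ ∑[ i < n ] f i
∑-involution {P = P} inv f = sym (∑-permute f (permutation P P inv inv))

card-by-partner : ∀ {n} (P : Fin n → Fin n) (p : Fin n → Bool) →
  card n p ≡ card n (λ w → p w ∧ isOpen P w) + card n (λ w → p w ∧ isOpener P w) + card n (λ w → p w ∧ P w <ᶠ w)
card-by-partner {n} P p =
  trans (sum-cong-≗ split) (trans (∑-distrib-+ (λ w → fixed w + opening w) closing) (cong (_+ ∑[ w < n ] closing w) (∑-distrib-+ fixed opening)))
  where
  fixed opening closing : Fin n → ℕ
  fixed   w = indicator (p w ∧ isOpen P w)
  opening w = indicator (p w ∧ isOpener P w)
  closing w = indicator (p w ∧ P w <ᶠ w)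
  split : ∀ w → indicator (p w) ≡ indicator (p w ∧ isOpen P w) + indicator (p w ∧ isOpener P w) + indicator (p w ∧ P w <ᶠ w)
  split w with p w
  ... | false = refl
  ... | true with compare w (P w)
  ...   | less    w<Pw Pw≮w w≠Pw rewrite ==ᶠ-sym (P w) w | w≠Pw | w<Pw | Pw≮w = refl
  ...   | equal   w≡Pw rewrite sym w≡Pw | ==ᶠ-refl w | <ᶠ-irrefl w = refl
  ...   | greater w≮Pw Pw<w w≠Pw rewrite ==ᶠ-sym (P w) w | w≠Pw | w≮Pw | Pw<w = refl

-- The newly read vertex becomes vertex 0 and the old vertices shift up by one; openStep
-- leaves it open, closeStep matches it with the open vertex a.
openStep : ∀ {n} → (Fin n → Fin n) → Fin (suc n) → Fin (suc n)
openStep P Fin.zero    = Fin.zero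
openStep P (Fin.suc i) = Fin.suc (P i)

redirect : ∀ {n} → Fin n → Fin n → Fin (suc n)
redirect a x = if x ==ᶠ a then Fin.zero else Fin.suc x

closeStep : ∀ {n} → (Fin n → Fin n) → Fin n → Fin (suc n) → Fin (suc n)
closeStep P a Fin.zero    = Fin.suc a
closeStep P a (Fin.suc i) = redirect a (P i)

module OpenStep {n} (P : Fin n → Fin n) where

  involution : IsInvolution P → IsInvolution (openStep P)
  involution inv Fin.zero    = refl
  involution inv (Fin.suc i) = cong Fin.suc (inv i)

  vertexDepthSum-step : vertexDepthSum (openStep P) ≡ vertexDepthSum P
  vertexDepthSum-step = cong (_+ vertexDepthSum P) (∑-zero n λ _ → refl)

  openDepthSum-step : openDepthSum (openStep P) ≡ openDepthSum P
  openDepthSum-step = cong (_+ openDepthSum P) (∑-zero n λ _ → refl)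

  balanced-step : ∀ {c h e} → Balanced c h e P → Balanced c (suc h) ((c + c) + e) (openStep P)
  balanced-step {c} {h} {e} bal = begin
    vertexDepthSum (openStep P) + openDepthSum (openStep P) + ((c + c) + e)
      ≡⟨ cong₂ (λ x y → x + y + ((c + c) + e)) vertexDepthSum-step openDepthSum-step ⟩
    vertexDepthSum P + openDepthSum P + ((c + c) + e)  ≡⟨ rearrange (vertexDepthSum P) (openDepthSum P) (c + c) e ⟩
    vertexDepthSum P + openDepthSum P + e + (c + c)    ≡⟨ cong (_+ (c + c)) bal ⟩
    arcDepthSum P + κ c h + (c + c)                    ≡⟨ ℕP.+-assoc (arcDepthSum P) (κ c h) (c + c) ⟩
    arcDepthSum P + (κ c h + (c + c))                  ≡⟨ cong (arcDepthSum P +_) (sym (κ-suc c h)) ⟩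
    arcDepthSum (openStep P) + κ c (suc h)             ∎
    where
    open ≡-Reasoning
    rearrange : ∀ d q c e → d + q + (c + e) ≡ d + q + e + c
    rearrange = solve-∀

  valid-step : ∀ {c h e} → Valid h c e P → Valid (suc h) c ((c + c) + e) (openStep P)
  valid-step {c} {h} {e} (valid inv #open bal) = valid (involution inv) (cong suc #open) (balanced-step {c} {h} {e} bal)

redirect-at : ∀ {n} (a : Fin n) → redirect a a ≡ Fin.zero
redirect-at a = cong (λ b → if b then Fin.zero else Fin.suc a) (==ᶠ-refl a)

redirect-away : ∀ {n} {a x : Fin n} → (x ==ᶠ a) ≡ false → redirect a x ≡ Fin.suc x
redirect-away {x = x} x≠a = cong (λ b → if b then Fin.zero else Fin.suc x) x≠a

module CloseStep {n} (P : Fin n → Fin n) (inv : IsInvolution P) (a : Fin n) (a-open : P a ≡ a) where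

  P′ : Fin (suc n) → Fin (suc n)
  P′ = closeStep P a

  data Position (i : Fin n) : Set where
    at   : i ≡ a → Position i
    away : (P i ==ᶠ a) ≡ false → (i ==ᶠ a) ≡ false → Position i

  position : ∀ i → Position i
  position i with i ==ᶠ a in i==a
  ... | true  = at (==ᶠ⇒≡ i==a)
  ... | false = away (≢⇒==ᶠ-false Pi≢a) i==a
    where
    Pi≢a : P i ≢ a
    Pi≢a Pi≡a with () ← trans (sym i==a) (trans (cong (_==ᶠ a) (trans (sym (inv i)) (trans (cong P Pi≡a) a-open))) (==ᶠ-refl a))

  P′-away : ∀ {i} → (P i ==ᶠ a) ≡ false → P′ (Fin.suc i) ≡ Fin.suc (P i)
  P′-away = redirect-away

  P′-at : P′ (Fin.suc a) ≡ Fin.zero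
  P′-at = trans (cong (redirect a) a-open) (redirect-at a)

  involution : IsInvolution P′
  involution Fin.zero = P′-at
  involution (Fin.suc i) with position i
  ... | at refl         = cong P′ P′-at
  ... | away Pi≠a i≠a   = trans (cong P′ (P′-away Pi≠a)) (trans (cong (redirect a) (inv i)) (redirect-away i≠a))

  a-isOpen : isOpen P a ≡ true
  a-isOpen = trans (cong (_==ᶠ a) a-open) (==ᶠ-refl a)

  a-notOpener : isOpener P a ≡ false
  a-notOpener = trans (cong (a <ᶠ_) a-open) (<ᶠ-irrefl a)

  isOpener-suc : ∀ u → isOpener P′ (Fin.suc u) ≡ isOpener P u
  isOpener-suc u with position u
  ... | at refl     = trans (cong (Fin.suc a <ᶠ_) P′-at) (sym a-notOpener)
  ... | away Pu≠a _ = cong (Fin.suc u <ᶠ_) (P′-away Pu≠a)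

  isOpen-suc : ∀ f → isOpen P′ (Fin.suc f) ≡ not (f ==ᶠ a) ∧ isOpen P f
  isOpen-suc f with position f
  ... | at refl       = trans (cong (_==ᶠ Fin.suc a) P′-at) (cong (λ b → not b ∧ isOpen P a) (sym (==ᶠ-refl a)))
  ... | away Pf≠a f≠a = trans (cong (_==ᶠ Fin.suc f) (P′-away Pf≠a)) (cong (λ b → not b ∧ isOpen P f) (sym f≠a))

  openersBelow-suc : ∀ f → openersBelow P′ (Fin.suc f) ≡ suc (openersBelow P f)
  openersBelow-suc f = cong suc (card-cong n λ u → cong (u <ᶠ f ∧_) (isOpener-suc u))

  vertexDepth-suc : ∀ w → vertexDepth P′ (Fin.suc w) ≡ indicator (w <ᶠ a) + vertexDepth P w
  vertexDepth-suc w = cong (indicator (w <ᶠ a) +_) (card-cong n same)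
    where
    same : ∀ i → (i <ᶠ w ∧ Fin.suc w <ᶠ P′ (Fin.suc i)) ≡ (i <ᶠ w ∧ w <ᶠ P i)
    same i with position i
    ... | at refl rewrite P′-at | a-open = trans (BoolP.∧-zeroʳ (a <ᶠ w)) (sym (<ᶠ-asym a w))
    ... | away Pi≠a _ rewrite P′-away Pi≠a = refl

  vertexDepthSum-step : vertexDepthSum P′ ≡ toℕ a + vertexDepthSum P
  vertexDepthSum-step = begin
    vertexDepthSum P′                                   ≡⟨ cong (_+ ∑[ w < n ] vertexDepth P′ (Fin.suc w)) (∑-zero n λ _ → refl) ⟩
    ∑[ w < n ] vertexDepth P′ (Fin.suc w)               ≡⟨ sum-cong-≗ vertexDepth-suc ⟩
    ∑[ w < n ] (indicator (w <ᶠ a) + vertexDepth P w)   ≡⟨ ∑-distrib-+ (indicator ∘ (_<ᶠ a)) (vertexDepth P) ⟩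
    card n (_<ᶠ a) + vertexDepthSum P                   ≡⟨ cong (_+ vertexDepthSum P) (card-< n a) ⟩
    toℕ a + vertexDepthSum P                            ∎
    where open ≡-Reasoning

  arcDepth-suc : ∀ u → isOpener P u ≡ true → arcDepth P′ (Fin.suc u) ≡ indicator (P u <ᶠ a) + arcDepth P u
  arcDepth-suc u u-opener with position u
  ... | at refl with () ← trans (sym a-notOpener) u-opener
  ... | away Pu≠a _ rewrite P′-away Pu≠a = cong₂ _+_ (cong indicator (BoolP.∧-identityʳ (P u <ᶠ a))) (card-cong n same)
    where
    same : ∀ i → (i <ᶠ u ∧ (Fin.suc (P u) <ᶠ P′ (Fin.suc i) ∧ isOpener P′ (Fin.suc i))) ≡ (i <ᶠ u ∧ (P u <ᶠ P i ∧ isOpener P i))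
    same i with position i
    ... | at refl rewrite P′-at | a-notOpener =
      trans (BoolP.∧-zeroʳ (a <ᶠ u)) (sym (trans (cong (a <ᶠ u ∧_) (BoolP.∧-zeroʳ (P u <ᶠ P a))) (BoolP.∧-zeroʳ (a <ᶠ u))))
    ... | away Pi≠a _ rewrite P′-away Pi≠a = refl

  arcDepthSum-step : arcDepthSum P′ ≡ arcDepthSum P + card n (λ u → P u <ᶠ a ∧ isOpener P u)
  arcDepthSum-step = begin
    arcDepthSum P′                                ≡⟨ cong (_+ ∑[ u < n ] stepped u) (∑-zero (suc n) λ _ → refl) ⟩
    ∑[ u < n ] stepped u                          ≡⟨ sum-cong-≗ same ⟩
    ∑[ u < n ] (old u + indicator (P u <ᶠ a ∧ isOpener P u))
                                                  ≡⟨ ∑-distrib-+ old (λ u → indicator (P u <ᶠ a ∧ isOpener P u)) ⟩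
    arcDepthSum P + card n (λ u → P u <ᶠ a ∧ isOpener P u) ∎
    where
    open ≡-Reasoning
    stepped old : Fin n → ℕ
    stepped u = if isOpener P′ (Fin.suc u) then arcDepth P′ (Fin.suc u) else 0
    old     u = if isOpener P u then arcDepth P u else 0
    same : ∀ u → stepped u ≡ old u + indicator (P u <ᶠ a ∧ isOpener P u)
    same u rewrite isOpener-suc u with isOpener P u in u-opener
    ... | false = cong indicator (sym (BoolP.∧-zeroʳ (P u <ᶠ a)))
    ... | true  = trans (arcDepth-suc u u-opener)
                    (trans (ℕP.+-comm (indicator (P u <ᶠ a)) (arcDepth P u)) (cong (λ b → arcDepth P u + indicator b) (sym (BoolP.∧-identityʳ _))))

  othersOpen : ℕ
  othersOpen = card n (λ f → not (f ==ᶠ a) ∧ isOpen P f)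

  ∑-open-split : ∀ (g : Fin n → ℕ) →
    ∑[ f < n ] (if isOpen P f then g f else 0) ≡ ∑[ f < n ] (if not (f ==ᶠ a) ∧ isOpen P f then g f else 0) + g a
  ∑-open-split g = trans (sum-cong-≗ same)
    (trans (∑-distrib-+ others (λ f → if f ==ᶠ a then g f else 0)) (cong (∑[ f < n ] others f +_) (∑-if-== n a g)))
    where
    others : Fin n → ℕ
    others f = if not (f ==ᶠ a) ∧ isOpen P f then g f else 0
    same : ∀ f → (if isOpen P f then g f else 0) ≡ others f + (if f ==ᶠ a then g f else 0)
    same f with position f
    ... | at refl rewrite a-isOpen | ==ᶠ-refl a = refl
    ... | away _ f≠a rewrite f≠a = sym (ℕP.+-identityʳ _)

  openCount-split : openCount P ≡ suc othersOpen
  openCount-split = trans (∑-open-split (λ _ → 1)) (ℕP.+-comm othersOpen 1)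

  openCount-step : openCount P′ ≡ othersOpen
  openCount-step = card-cong n isOpen-suc

  openDepthSum-step : openDepthSum P′ + openersBelow P a ≡ othersOpen + openDepthSum P
  openDepthSum-step = begin
    openDepthSum P′ + openersBelow P a
      ≡⟨ cong (_+ openersBelow P a) (trans (sum-cong-≗ same) (∑-distrib-+ _ remaining)) ⟩
    othersOpen + ∑[ f < n ] remaining f + openersBelow P a          ≡⟨ ℕP.+-assoc othersOpen _ _ ⟩
    othersOpen + (∑[ f < n ] remaining f + openersBelow P a)        ≡⟨ cong (othersOpen +_) (sym (∑-open-split (openersBelow P))) ⟩
    othersOpen + openDepthSum P                                     ∎
    where
    open ≡-Reasoning
    remaining : Fin n → ℕ
    remaining f = if not (f ==ᶠ a) ∧ isOpen P f then openersBelow P f else 0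
    same : ∀ f → (if isOpen P′ (Fin.suc f) then openersBelow P′ (Fin.suc f) else 0) ≡ indicator (not (f ==ᶠ a) ∧ isOpen P f) + remaining f
    same f rewrite isOpen-suc f | openersBelow-suc f with not (f ==ᶠ a) ∧ isOpen P f
    ... | true  = refl
    ... | false = refl

  othersOpen-split : othersOpen ≡ card n (λ w → w <ᶠ a ∧ isOpen P w) + openAbove P a
  othersOpen-split = card-split n same
    where
    same : ∀ f → indicator (not (f ==ᶠ a) ∧ isOpen P f) ≡ indicator (f <ᶠ a ∧ isOpen P f) + indicator (a <ᶠ f ∧ isOpen P f)
    same f with compare f a
    ... | less    f<a a≮f f≠a rewrite f≠a | f<a | a≮f = sym (ℕP.+-identityʳ _)
    ... | equal   refl        rewrite ==ᶠ-refl f | <ᶠ-irrefl f = refl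
    ... | greater f≮a a<f f≠a rewrite f≠a | f≮a | a<f = refl

  closersBelow : card n (λ w → w <ᶠ a ∧ P w <ᶠ w) ≡ card n (λ u → P u <ᶠ a ∧ isOpener P u)
  closersBelow = trans (sym (∑-involution inv (λ w → indicator (w <ᶠ a ∧ P w <ᶠ w))))
                   (sum-cong-≗ λ u → cong (λ x → indicator (P u <ᶠ a ∧ x <ᶠ P u)) (inv u))

  toℕ-a-by-partner : toℕ a ≡ card n (λ w → w <ᶠ a ∧ isOpen P w) + openersBelow P a + card n (λ u → P u <ᶠ a ∧ isOpener P u)
  toℕ-a-by-partner = trans (sym (card-< n a)) (trans (card-by-partner P (_<ᶠ a))
            (cong (card n (λ w → w <ᶠ a ∧ isOpen P w) + openersBelow P a +_) closersBelow))

  othersOpen≡ : ∀ {h} → openCount P ≡ suc h → othersOpen ≡ h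
  othersOpen≡ #open≡1+h = ℕP.suc-injective (trans (sym openCount-split) #open≡1+h)

  balanced-step : ∀ {c h e} → Balanced c (suc h) e P → openCount P ≡ suc h → Balanced (suc c) h (e + openAbove P a) P′
  balanced-step {c} {h} {e} bal #open≡1+h = begin
    vertexDepthSum P′ + Q′ + (e + R)            ≡⟨ cong (λ x → x + Q′ + (e + R)) (trans vertexDepthSum-step (cong (_+ D) toℕ-a-by-partner)) ⟩
    F + L + N + D + Q′ + (e + R)                ≡⟨ rearrange₁ F L N D Q′ e R ⟩
    D + e + N + (F + R) + (Q′ + L)              ≡⟨ cong₂ (λ x y → D + e + N + x + y) (trans (sym othersOpen-split) others≡h)
                                                                                      (trans openDepthSum-step (cong (_+ Q) others≡h)) ⟩
    D + e + N + h + (h + Q)                     ≡⟨ rearrange₂ D e N h Q ⟩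
    D + Q + e + N + (h + h)                     ≡⟨ cong (λ x → x + N + (h + h)) bal ⟩
    A + κ c (suc h) + N + (h + h)               ≡⟨ rearrange₃ A (κ c (suc h)) N (h + h) ⟩
    A + N + κ (suc c) h                         ≡⟨ cong (_+ κ (suc c) h) (sym arcDepthSum-step) ⟩
    arcDepthSum P′ + κ (suc c) h                ∎
    where
    open ≡-Reasoning
    D = vertexDepthSum P
    Q = openDepthSum P
    Q′ = openDepthSum P′
    A = arcDepthSum P
    F = card n (λ w → w <ᶠ a ∧ isOpen P w)
    L = openersBelow P a
    N = card n (λ u → P u <ᶠ a ∧ isOpener P u)
    R = openAbove P a
    others≡h : othersOpen ≡ h
    others≡h = othersOpen≡ #open≡1+h
    rearrange₁ : ∀ f l n d q e r → f + l + n + d + q + (e + r) ≡ d + e + n + (f + r) + (q + l)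
    rearrange₁ = solve-∀
    rearrange₂ : ∀ d e n h q → d + e + n + h + (h + q) ≡ d + q + e + n + (h + h)
    rearrange₂ = solve-∀
    rearrange₃ : ∀ a k n m → a + k + n + m ≡ a + n + (k + m)
    rearrange₃ = solve-∀

  valid-step : ∀ {c h e} → Valid (suc h) c e P → Valid h (suc c) (e + openAbove P a) P′
  valid-step {c} {h} {e} (valid _ #open bal) = valid involution (trans openCount-step (othersOpen≡ #open)) (balanced-step {c} {h} {e} bal #open)

unredirect : ∀ {n} → Fin n → Fin (suc n) → Fin n
unredirect a Fin.zero    = a
unredirect a (Fin.suc x) = x

unredirect-redirect : ∀ {n} (a x : Fin n) → unredirect a (redirect a x) ≡ x
unredirect-redirect a x with x ==ᶠ a in x==a
... | true  = sym (==ᶠ⇒≡ x==a)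
... | false = refl

redirect-unredirect : ∀ {n} (a : Fin n) y → y ≢ Fin.suc a → redirect a (unredirect a y) ≡ y
redirect-unredirect a Fin.zero    _     = redirect-at a
redirect-unredirect a (Fin.suc x) x≢a = redirect-away (≢⇒==ᶠ-false (x≢a ∘ cong Fin.suc))

redirect-injective : ∀ {n} (a : Fin n) {x y} → redirect a x ≡ redirect a y → x ≡ y
redirect-injective a {x} {y} eq = trans (sym (unredirect-redirect a x)) (trans (cong (unredirect a) eq) (unredirect-redirect a y))

openStep-involution⁻ : ∀ {n} {P : Fin n → Fin n} → IsInvolution (openStep P) → IsInvolution P
openStep-involution⁻ inv i = FinP.suc-injective (inv (Fin.suc i))

closeStep-involution⁻ : ∀ {n} {P : Fin n → Fin n} {a} → IsInvolution (closeStep P a) → IsInvolution P × P a ≡ a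
closeStep-involution⁻ {P = P} {a} inv = involutive , Pa≡a
  where
  Pa≡a : P a ≡ a
  Pa≡a = trans (sym (unredirect-redirect a (P a))) (cong (unredirect a) (inv Fin.zero))
  involutive : IsInvolution P
  involutive i with P i ==ᶠ a in Pi==a
  ... | true  = trans (cong P Pi≡a) (trans Pa≡a a≡i)
    where
    Pi≡a = ==ᶠ⇒≡ Pi==a
    a≡i : a ≡ i
    a≡i = FinP.suc-injective (trans (cong (closeStep P a) (sym (trans (cong (redirect a) Pi≡a) (redirect-at a)))) (inv (Fin.suc i)))
  ... | false = trans (sym (unredirect-redirect a (P (P i))))
                  (cong (unredirect a) (trans (cong (closeStep P a) (sym (redirect-away Pi==a))) (inv (Fin.suc i))))

PartnerMap : ℕ → Set
PartnerMap n = Vec (Fin n) n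

openVec : ∀ {n} → PartnerMap n → PartnerMap (suc n)
openVec v = Fin.zero ∷ Vec.map Fin.suc v

closeVec : ∀ {n} → PartnerMap n → Fin n → PartnerMap (suc n)
closeVec v a = Fin.suc a ∷ Vec.map (redirect a) v

lookup-openVec : ∀ {n} (v : PartnerMap n) i → openStep (lookup v) i ≡ lookup (openVec v) i
lookup-openVec v Fin.zero    = refl
lookup-openVec v (Fin.suc i) = sym (VecP.lookup-map i Fin.suc v)

lookup-closeVec : ∀ {n} (v : PartnerMap n) a i → closeStep (lookup v) a i ≡ lookup (closeVec v a) i
lookup-closeVec v a Fin.zero    = refl
lookup-closeVec v a (Fin.suc i) = sym (VecP.lookup-map i (redirect a) v)

openVec-injective : ∀ {n} {u u′ : PartnerMap n} → openVec u ≡ openVec u′ → u ≡ u′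
openVec-injective eq = map-injective FinP.suc-injective (VecP.∷-injectiveʳ eq)

closeVec-injective : ∀ {n} {u u′ : PartnerMap n} {a a′} → closeVec u a ≡ closeVec u′ a′ → u ≡ u′ × a ≡ a′
closeVec-injective {a = a} eq with FinP.suc-injective (VecP.∷-injectiveˡ eq)
... | refl = map-injective (redirect-injective a) (VecP.∷-injectiveʳ eq) , refl

openVec≢closeVec : ∀ {n} {u u′ : PartnerMap n} {a} → openVec u ≢ closeVec u′ a
openVec≢closeVec eq = FinP.0≢1+n (VecP.∷-injectiveˡ eq)

PartnerMap-decompose : ∀ {n} (v : PartnerMap (suc n)) → IsInvolution (lookup v) →
  (∃ λ w → openVec w ≡ v) ⊎ (∃₂ λ w a → closeVec w a ≡ v)
PartnerMap-decompose (Fin.zero ∷ w) inv = inj₁ (Vec.tabulate shrink , lookup-extensional same)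
  where
  0≢w : ∀ i → Fin.zero ≢ lookup w i
  0≢w i 0≡wi = FinP.0≢1+n (trans (cong (lookup (Fin.zero ∷ w)) 0≡wi) (inv (Fin.suc i)))
  shrink : Fin _ → Fin _
  shrink i = punchOut (0≢w i)
  same : ∀ i → lookup (openVec (Vec.tabulate shrink)) i ≡ lookup (Fin.zero ∷ w) i
  same Fin.zero    = refl
  same (Fin.suc i) = trans (VecP.lookup-map i Fin.suc (Vec.tabulate shrink))
    (trans (cong Fin.suc (VecP.lookup∘tabulate shrink i)) (FinP.punchIn-punchOut (0≢w i)))
PartnerMap-decompose (Fin.suc a ∷ w) inv = inj₂ (Vec.map (unredirect a) w , a , lookup-extensional same)
  where
  same : ∀ i → lookup (closeVec (Vec.map (unredirect a) w) a) i ≡ lookup (Fin.suc a ∷ w) i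
  same Fin.zero    = refl
  same (Fin.suc i) = trans (VecP.lookup-map i (redirect a) (Vec.map (unredirect a) w)) (trans (cong (redirect a) (VecP.lookup-map i (unredirect a) w))
    (redirect-unredirect a (lookup w i) λ wi≡1+a →
      FinP.0≢1+n (sym (involution-injective {P = lookup (Fin.suc a ∷ w)} inv {Fin.suc i} {Fin.zero} wi≡1+a))))

openVertices : ∀ {n} → (Fin n → Fin n) → List (Fin n)
openVertices {n} P = filter (λ a → isOpen P a ≟ᵇ true) (allFin n)

Weighted : ℕ → Set
Weighted n = PartnerMap n × ℕ

opening : ∀ {n} → ℕ → Weighted n → Weighted (suc n)
opening c (v , e) = openVec v , (c + c) + e

closings : ∀ {n} → Weighted n → List (Weighted (suc n))
closings (v , e) = map (λ a → closeVec v a , e + openAbove (lookup v) a) (openVertices (lookup v))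

-- histories n h c: the partial matchings on n vertices with h open and c closed arcs, each
-- paired with the exponent accumulated while reading it.
mutual
  histories : (n h c : ℕ) → List (Weighted n)
  histories zero    zero    zero    = [ [] , 0 ]
  histories zero    (suc h) c       = []
  histories zero    zero    (suc c) = []
  histories (suc n) h       c       = openedHistories n h c ++ closedHistories n h c

  openedHistories : (n h c : ℕ) → List (Weighted (suc n))
  openedHistories n zero    c = []
  openedHistories n (suc h) c = map (opening c) (histories n h c)

  closedHistories : (n h c : ℕ) → List (Weighted (suc n))
  closedHistories n h zero    = []
  closedHistories n h (suc c) = concatMap closings (histories n (suc h) c)

∈-closings⁻ : ∀ {n} {v : PartnerMap n} {e x} → x ∈ closings (v , e) →
  ∃ λ a → isOpen (lookup v) a ≡ true × x ≡ (closeVec v a , e + openAbove (lookup v) a)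
∈-closings⁻ {v = v} x∈ with ∈P.∈-map⁻ _ x∈
... | a , a∈ , refl = a , proj₂ (∈P.∈-filter⁻ (λ a → isOpen (lookup v) a ≟ᵇ true) {xs = allFin _} a∈) , refl

ValidHistory : ∀ {n} → ℕ → ℕ → Weighted n → Set
ValidHistory h c (v , e) = Valid h c e (lookup v)

histories-valid : ∀ n h c {x} → x ∈ histories n h c → ValidHistory h c x
histories-valid zero    zero    zero    (here refl) = valid (λ ()) refl refl
histories-valid (suc n) h       c       x∈ with ∈P.∈-++⁻ (openedHistories n h c) x∈
histories-valid (suc n) (suc h) c       x∈ | inj₁ x∈opened with ∈P.∈-map⁻ (opening c) x∈opened
... | (v , e) , y∈ , refl = Pointwise.valid-≗ (lookup-openVec v) (OpenStep.valid-step (lookup v) (histories-valid n h c y∈))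
histories-valid (suc n) h       (suc c) x∈ | inj₂ x∈closed with ∈P.∈-concatMap⁻ closings {xs = histories n (suc h) c} x∈closed
... | any-y with find any-y
...   | (v , e) , y∈ , x∈closings with ∈-closings⁻ x∈closings
...     | a , a-open , refl = Pointwise.valid-≗ (lookup-closeVec v a) (CloseStep.valid-step P (Valid.involutive valid-y) a (==ᶠ⇒≡ a-open) valid-y)
  where
  P = lookup v
  valid-y = histories-valid n (suc h) c y∈

∈-map-closings⁻ : ∀ {n} {x : Weighted n} {y} → y ∈ map proj₁ (closings x) → ∃ λ a → y ≡ closeVec (proj₁ x) a
∈-map-closings⁻ y∈ with ∈P.∈-map⁻ proj₁ y∈
... | z , z∈ , refl with ∈-closings⁻ z∈
...   | a , _ , refl = a , refl

closings-unique : ∀ {n} (x : Weighted n) → Unique (map proj₁ (closings x))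
closings-unique {n} (v , e) = subst Unique (ListP.map-∘ (openVertices (lookup v)))
  (UniqueP.map⁺ (proj₂ ∘ closeVec-injective) (UniqueP.filter⁺ (λ a → isOpen (lookup v) a ≟ᵇ true) (UniqueP.allFin⁺ n)))

concatMap-closings-unique : ∀ {n} (xs : List (Weighted n)) → Unique (map proj₁ xs) → Unique (map proj₁ (concatMap closings xs))
concatMap-closings-unique xs xs-unique = subst Unique (sym (ListP.map-concatMap proj₁ closings xs))
  (concatMap-unique same-source closings-unique xs-unique)
  where
  same-source : ∀ {x x′ : Weighted _} {y} → y ∈ map proj₁ (closings x) → y ∈ map proj₁ (closings x′) → proj₁ x ≡ proj₁ x′
  same-source {x} {x′} y∈ y∈′ with ∈-map-closings⁻ {x = x} y∈ | ∈-map-closings⁻ {x = x′} y∈′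
  ... | _ , y≡ | _ , y≡′ = proj₁ (closeVec-injective (trans (sym y≡) y≡′))

∈-opened⁻ : ∀ n h c {y} → y ∈ map proj₁ (openedHistories n h c) → ∃ λ w → y ≡ openVec w
∈-opened⁻ n (suc h) c y∈ with ∈P.∈-map⁻ proj₁ y∈
... | x , x∈ , refl with ∈P.∈-map⁻ (opening c) x∈
...   | z , _ , refl = proj₁ z , refl

∈-closed⁻ : ∀ n h c {y} → y ∈ map proj₁ (closedHistories n h c) → ∃₂ λ w a → y ≡ closeVec w a
∈-closed⁻ n h (suc c) y∈
  with find (∈P.∈-concatMap⁻ (map proj₁ ∘ closings) {xs = histories n (suc h) c}
              (subst (_ ∈_) (ListP.map-concatMap proj₁ closings (histories n (suc h) c)) y∈))
... | x , _ , y∈closings = proj₁ x , ∈-map-closings⁻ {x = x} y∈closings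

opened-closed-disjoint : ∀ n h c → Disjoint (map proj₁ (openedHistories n h c)) (map proj₁ (closedHistories n h c))
opened-closed-disjoint n h c (y∈opened , y∈closed) with ∈-opened⁻ n h c y∈opened | ∈-closed⁻ n h c y∈closed
... | _ , y≡ | _ , _ , y≡′ = openVec≢closeVec (trans (sym y≡) y≡′)

histories-unique : ∀ n h c → Unique (map proj₁ (histories n h c))
histories-unique zero    zero    zero    = All.[] AllPairs.∷ AllPairs.[]
histories-unique zero    (suc h) c       = AllPairs.[]
histories-unique zero    zero    (suc c) = AllPairs.[]
histories-unique (suc n) h       c       = subst Unique (sym (ListP.map-++ proj₁ (openedHistories n h c) (closedHistories n h c)))
  (UniqueP.++⁺ (opened-unique h c) (closed-unique h c) (opened-closed-disjoint n h c))
  where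
  opened-unique : ∀ h c → Unique (map proj₁ (openedHistories n h c))
  opened-unique zero    c = AllPairs.[]
  opened-unique (suc h) c = subst Unique (trans (sym (ListP.map-∘ (histories n h c))) (ListP.map-∘ (histories n h c)))
                              (UniqueP.map⁺ openVec-injective (histories-unique n h c))
  closed-unique : ∀ h c → Unique (map proj₁ (closedHistories n h c))
  closed-unique h zero    = AllPairs.[]
  closed-unique h (suc c) = concatMap-closings-unique (histories n (suc h) c) (histories-unique n (suc h) c)

∈-closings⁺ : ∀ {n} {v : PartnerMap n} {a} e → isOpen (lookup v) a ≡ true → (closeVec v a , e + openAbove (lookup v) a) ∈ closings (v , e)
∈-closings⁺ {n} {v} {a} e a-open =
  ∈P.∈-map⁺ _ (∈P.∈-filter⁺ (λ a → isOpen (lookup v) a ≟ᵇ true) (∈P.∈-allFin a) a-open)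

histories-complete : ∀ n h c (v : PartnerMap n) → IsInvolution (lookup v) → openCount (lookup v) ≡ h → n ≡ c + c + h →
  ∃ λ e → (v , e) ∈ histories n h c
histories-complete zero    zero    zero    []  _   _     _  = 0 , here refl
histories-complete zero    (suc h) c       []  _   ()    _
histories-complete zero    zero    (suc c) []  _   _     ()
histories-complete (suc n) h       c       v   inv #open n≡ with PartnerMap-decompose v inv
... | inj₁ (w , refl) = subst (λ h → ∃ λ e → (openVec w , e) ∈ histories (suc n) h c) #open′ opened
  where
  module W = Pointwise (lookup-openVec w)
  #open′ : suc (openCount (lookup w)) ≡ h
  #open′ = trans W.openCount-≗ #open
  opened : ∃ λ e → (openVec w , e) ∈ histories (suc n) (suc (openCount (lookup w))) c
  opened with histories-complete n _ c w (openStep-involution⁻ (Pointwise.involution-≗ (sym ∘ lookup-openVec w) inv)) refl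
                (ℕP.suc-injective (trans n≡ (trans (cong (c + c +_) (sym #open′)) (ℕP.+-suc (c + c) _))))
  ... | e , w∈ = (c + c) + e , ∈P.∈-++⁺ˡ (∈P.∈-map⁺ (opening c) w∈)
... | inj₂ (w , a , refl) = closed c n≡
  where
  module W = Pointwise (lookup-closeVec w a)
  P = lookup w
  P-inv = closeStep-involution⁻ (Pointwise.involution-≗ (sym ∘ lookup-closeVec w a) inv)
  module C = CloseStep P (proj₁ P-inv) a (proj₂ P-inv)
  #open′ : openCount P ≡ suc h
  #open′ = trans C.openCount-split (cong suc (trans (sym C.openCount-step) (trans W.openCount-≗ #open)))
  closed : ∀ c → suc n ≡ c + c + h → ∃ λ e → (closeVec w a , e) ∈ histories (suc n) h c
  closed zero    n+1≡h = ⊥-elim (ℕP.1+n≰n (ℕP.≤-trans (ℕP.n≤1+n (suc n)) (subst (λ x → suc x ≤ n) (sym n+1≡h) #open≤n)))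
    where
    #open≤n : suc h ≤ n
    #open≤n = subst (_≤ n) #open′ (card≤ n (isOpen P))
  closed (suc c) n≡′ with histories-complete n (suc h) c w (proj₁ P-inv) #open′ (trans (ℕP.suc-injective n≡′) (arith c h))
    where
    arith : ∀ c h → c + suc c + h ≡ c + c + suc h
    arith = solve-∀
  ... | e , w∈ = e + openAbove P a , ∈P.∈-++⁺ʳ (openedHistories n h (suc c))
                   (∈P.∈-concatMap⁺ closings (lose w∈ (∈-closings⁺ e C.a-isOpen)))

allVecs-complete : ∀ k m (v : Vec (Fin k) m) → v ∈ allVecs k m
allVecs-complete k zero    []      = here refl
allVecs-complete k (suc m) (x ∷ v) =
  ∈P.∈-concatMap⁺ (λ y → map (y ∷_) (allVecs k m)) (lose (∈P.∈-allFin x) (∈P.∈-map⁺ (x ∷_) (allVecs-complete k m v)))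

allVecs-unique : ∀ k m → Unique (allVecs k m)
allVecs-unique k zero    = All.[] AllPairs.∷ AllPairs.[]
allVecs-unique k (suc m) = concatMap-unique same-head (λ _ → UniqueP.map⁺ VecP.∷-injectiveʳ (allVecs-unique k m))
  (subst Unique (sym (ListP.map-id (allFin k))) (UniqueP.allFin⁺ k))
  where
  same-head : ∀ {x x′} {y : Vec (Fin k) (suc m)} → y ∈ map (x ∷_) (allVecs k m) → y ∈ map (x′ ∷_) (allVecs k m) → x ≡ x′
  same-head y∈ y∈′ with ∈P.∈-map⁻ _ y∈ | ∈P.∈-map⁻ _ y∈′
  ... | _ , _ , refl | _ , _ , y≡ = VecP.∷-injectiveˡ y≡

IsPM⇒ : ∀ {m} (v : Vec (Fin m) m) → IsPM v → IsInvolution (lookup v) × openCount (lookup v) ≡ 0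
IsPM⇒ {m} v pm = proj₁ ∘ pm , card-false m (λ i → ≢⇒==ᶠ-false (proj₂ (pm i)))

⇒IsPM : ∀ {m} (v : Vec (Fin m) m) → IsInvolution (lookup v) → openCount (lookup v) ≡ 0 → IsPM v
⇒IsPM {m} v inv #open i = inv i , λ vi≡i →
  case trans (sym (card≡0⇒false m (isOpen (lookup v)) #open i)) (trans (cong (_==ᶠ i) vi≡i) (==ᶠ-refl i)) of λ ()

PM-↭ : ∀ n → map proj₁ (histories (2 * n) 0 n) ↭ PM n
PM-↭ n = unique-↭ (histories-unique (2 * n) 0 n) (UniqueP.filter⁺ isPM? (allVecs-unique (2 * n) (2 * n))) sound complete
  where
  sound : ∀ {v} → v ∈ map proj₁ (histories (2 * n) 0 n) → v ∈ PM n
  sound v∈ with ∈P.∈-map⁻ proj₁ v∈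
  ... | (v , e) , x∈ , refl with histories-valid (2 * n) 0 n x∈
  ...   | valid inv #open _ = ∈P.∈-filter⁺ isPM? (allVecs-complete _ _ v) (⇒IsPM v inv #open)
  complete : ∀ {v} → v ∈ PM n → v ∈ map proj₁ (histories (2 * n) 0 n)
  complete {v} v∈ with IsPM⇒ v (proj₂ (∈P.∈-filter⁻ isPM? {xs = allVecs (2 * n) (2 * n)} v∈))
  ... | inv , #open with histories-complete (2 * n) 0 n v inv #open (2n≡n+n+0 n)
    where
    2n≡n+n+0 : ∀ n → 2 * n ≡ n + n + 0
    2n≡n+n+0 = solve-∀
  ...   | _ , x∈ = ∈P.∈-map⁺ proj₁ x∈

module _ {m} (v : PartnerMap m) where

  private
    P = lookup v

  isLeft≡isOpener : ∀ i → isLeft v i ≡ isOpener P i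
  isLeft≡isOpener i = ⌊<?⌋≡<ᵇ (toℕ i) (toℕ (P i))

  depthV≡vertexDepth : ∀ w → depthV v w ≡ vertexDepth P w
  depthV≡vertexDepth w = trans (sum-allFin m _) (card-cong m same)
    where
    same : ∀ i → (if isLeft v i then (if ⌊ toℕ i ℕP.<? toℕ w ⌋ then ⌊ toℕ w ℕP.<? toℕ (P i) ⌋ else false) else false)
                 ≡ (i <ᶠ w ∧ w <ᶠ P i)
    same i rewrite isLeft≡isOpener i | ⌊<?⌋≡<ᵇ (toℕ i) (toℕ w) | ⌊<?⌋≡<ᵇ (toℕ w) (toℕ (P i))
                 | if-then-false (i <ᶠ w) (w <ᶠ P i) with i <ᶠ w ∧ w <ᶠ P i in between
    ... | false = trans (if-then-false (isOpener P i) false) (BoolP.∧-zeroʳ _)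
    ... | true  = cong (λ b → if b then true else false) (<ᶠ-trans i w (P i) (proj₁ both) (proj₂ both))
      where
      both = ∧≡true⁻ (i <ᶠ w) (w <ᶠ P i) between

  depthA≡arcDepth : ∀ u → depthA v u ≡ arcDepth P u
  depthA≡arcDepth u = trans (sum-allFin m _) (card-cong m same)
    where
    same : ∀ i → (if isLeft v i then (if ⌊ toℕ i ℕP.<? toℕ u ⌋ then ⌊ toℕ (P u) ℕP.<? toℕ (P i) ⌋ else false) else false)
                 ≡ (i <ᶠ u ∧ (P u <ᶠ P i ∧ isOpener P i))
    same i rewrite isLeft≡isOpener i | ⌊<?⌋≡<ᵇ (toℕ i) (toℕ u) | ⌊<?⌋≡<ᵇ (toℕ (P u)) (toℕ (P i))
                 | if-then-false (i <ᶠ u) (P u <ᶠ P i) | if-then-false (isOpener P i) (i <ᶠ u ∧ P u <ᶠ P i) =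
      trans (BoolP.∧-comm (isOpener P i) _) (BoolP.∧-assoc (i <ᶠ u) (P u <ᶠ P i) (isOpener P i))

  sumDepthV≡ : sumDepthV v ≡ vertexDepthSum P
  sumDepthV≡ = trans (sum-allFin m (depthV v)) (sum-cong-≗ depthV≡vertexDepth)

  sumDepthA≡ : sumDepthA v ≡ arcDepthSum P
  sumDepthA≡ = trans (sum-allFin m _) (sum-cong-≗ λ u → cong₂ (λ b x → if b then x else 0) (isLeft≡isOpener u) (depthA≡arcDepth u))

C2-suc : ∀ n → suc (suc n) C 2 ≡ suc n + suc n C 2
C2-suc n = trans (sym (nCk+nC[k+1]≡[n+1]C[k+1] (suc n) 1)) (cong (_+ suc n C 2) (nC1≡n (suc n)))

descendingSum : ℕ → ℕ → ℕ
descendingSum k n = sum (map (λ i → k ∸ suc i) (List.upTo n))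

descendingSum-suc : ∀ k n → descendingSum k (suc n) ≡ descendingSum k n + (k ∸ suc n)
descendingSum-suc k n = begin
  sum (map f (List.upTo (suc n)))           ≡⟨ cong (sum ∘ map f) (sym (ListP.upTo-∷ʳ n)) ⟩
  sum (map f (List.upTo n List.∷ʳ n))       ≡⟨ cong sum (ListP.map-++ f (List.upTo n) [ n ]) ⟩
  sum (map f (List.upTo n) ++ [ f n ])      ≡⟨ SumP.sum-++ (map f (List.upTo n)) [ f n ] ⟩
  descendingSum k n + (f n + 0)             ≡⟨ cong (descendingSum k n +_) (ℕP.+-identityʳ (f n)) ⟩
  descendingSum k n + (k ∸ suc n)           ∎
  where
  open ≡-Reasoning
  f : ℕ → ℕ
  f i = k ∸ suc i

descendingSum+C2 : ∀ k n → n ≤ k → descendingSum k n + suc n C 2 ≡ n * k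
descendingSum+C2 k zero    _   = refl
descendingSum+C2 k (suc n) n<k = begin
  descendingSum k (suc n) + suc (suc n) C 2                 ≡⟨ cong₂ _+_ (descendingSum-suc k n) (C2-suc n) ⟩
  descendingSum k n + (k ∸ suc n) + (suc n + suc n C 2)     ≡⟨ rearrange (descendingSum k n) (k ∸ suc n) (suc n) (suc n C 2) ⟩
  (descendingSum k n + suc n C 2) + (k ∸ suc n + suc n)     ≡⟨ cong₂ _+_ (descendingSum+C2 k n (ℕP.<⇒≤ n<k)) (ℕP.m∸n+n≡m n<k) ⟩
  n * k + k                                                 ≡⟨ ℕP.+-comm (n * k) k ⟩
  suc n * k                                                 ∎
  where
  open ≡-Reasoning
  rearrange : ∀ a b c d → a + b + (c + d) ≡ (a + d) + (b + c)
  rearrange = solve-∀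

C2+C2+κ : ∀ n → suc n C 2 + suc n C 2 + κ n 0 ≡ (2 * n) * n
C2+C2+κ zero    = refl
C2+C2+κ (suc n) = begin
  suc (suc n) C 2 + suc (suc n) C 2 + κ (suc n) 0      ≡⟨ cong₂ (λ x y → x + x + y) (C2-suc n) (trans (ℕP.+-identityʳ (κ n 1)) (κ-suc n 0)) ⟩
  (suc n + T) + (suc n + T) + (κ n 0 + (n + n))        ≡⟨ rearrange n T (κ n 0) ⟩
  (T + T + κ n 0) + (4 * n + 2)                        ≡⟨ cong (_+ (4 * n + 2)) (C2+C2+κ n) ⟩
  (2 * n) * n + (4 * n + 2)                            ≡⟨ square n ⟩
  (2 * suc n) * suc n                                  ∎
  where
  open ≡-Reasoning
  T = suc n C 2
  rearrange : ∀ n t k → (suc n + t) + (suc n + t) + (k + (n + n)) ≡ (t + t + k) + (4 * n + 2)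
  rearrange = solve-∀
  square : ∀ n → (2 * n) * n + (4 * n + 2) ≡ (2 * suc n) * suc n
  square = solve-∀

S≡C2+κ : ∀ n → S n ≡ suc n C 2 + κ n 0
S≡C2+κ n = ℕP.+-cancelʳ-≡ (suc n C 2) _ _ (begin
  S n + T                ≡⟨ descendingSum+C2 (2 * n) n (ℕP.m≤m+n n (n + 0)) ⟩
  n * (2 * n)            ≡⟨ ℕP.*-comm n (2 * n) ⟩
  (2 * n) * n            ≡⟨ sym (C2+C2+κ n) ⟩
  T + T + κ n 0          ≡⟨ ℕP.+-assoc T T (κ n 0) ⟩
  T + (T + κ n 0)        ≡⟨ ℕP.+-comm T (T + κ n 0) ⟩
  T + κ n 0 + T          ∎)
  where
  open ≡-Reasoning
  T = suc n C 2

t≡C2+exponent : ∀ n (v : PartnerMap (2 * n)) {e} → Valid 0 n e (lookup v) → t n v ≡ suc n C 2 + e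
t≡C2+exponent n v {e} (valid _ #open bal) = begin
  (S n + sumDepthA v) ∸ sumDepthV v   ≡⟨ cong₂ (λ x y → (x + y) ∸ sumDepthV v) (S≡C2+κ n) (sumDepthA≡ v) ⟩
  (T + κ n 0 + A) ∸ sumDepthV v       ≡⟨ cong₂ _∸_ (trans (rearrange T (κ n 0) A) (cong (T +_) (sym bal′))) (sumDepthV≡ v) ⟩
  (T + (D + e)) ∸ D                   ≡⟨ cong (_∸ D) (rearrange′ T D e) ⟩
  (T + e) + D ∸ D                     ≡⟨ ℕP.m+n∸n≡m (T + e) D ⟩
  T + e                               ∎
  where
  open ≡-Reasoning
  P = lookup v
  T = suc n C 2
  D = vertexDepthSum P
  A = arcDepthSum P
  no-open : openDepthSum P ≡ 0
  no-open = ∑-zero (2 * n) λ f → cong (λ b → if b then openersBelow P f else 0) (card≡0⇒false (2 * n) (isOpen P) #open f)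
  bal′ : D + e ≡ A + κ n 0
  bal′ = trans (cong (_+ e) (sym (ℕP.+-identityʳ D))) (trans (cong (λ x → D + x + e) (sym no-open)) bal)
  rearrange : ∀ t k a → t + k + a ≡ t + (a + k)
  rearrange = solve-∀
  rearrange′ : ∀ t d e → t + (d + e) ≡ t + e + d
  rearrange′ = solve-∀

module GeneratingFunction {c ℓ} (R : CommutativeSemiring c ℓ) (q : CommutativeSemiring.Carrier R) where

  open CommutativeSemiring R
    using (_≈_; 0#; 1#; setoid; rawSemiring; semiring; +-monoid; +-isCommutativeMonoid; +-cong; +-congˡ; +-identityˡ; +-identityʳ;
           +-assoc; +-comm; isEquivalence; *-cong; *-congˡ; *-congʳ; *-identityˡ; *-identityʳ; *-assoc; *-comm; zeroˡ; zeroʳ; distribˡ; distribʳ)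
    renaming (Carrier to A; _+_ to _⊕_; _*_ to _⊗_; refl to ≈-refl; sym to ≈-sym; trans to ≈-trans; reflexive to ≈-reflexive)
  open import Algebra.Properties.Semiring.Exp semiring using (^-homo-*)
  open import Algebra.Solver.Ring.NaturalCoefficients.Default R using (solve; _:+_; _:*_; _:=_; con)
  open import Relation.Binary.Reasoning.Setoid setoid
  private module ∑ᴿ = Algebra.Properties.Monoid.Sum +-monoid

  q^ : ℕ → A
  q^ m = _^_ rawSemiring q m

  listSum : List A → A
  listSum = sumR R

  listSum-++ : ∀ xs ys → listSum (xs ++ ys) ≈ listSum xs ⊕ listSum ys
  listSum-++ []       ys = ≈-sym (+-identityˡ (listSum ys))
  listSum-++ (x ∷ xs) ys = ≈-trans (+-congˡ (listSum-++ xs ys)) (≈-sym (+-assoc x (listSum xs) (listSum ys)))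

  listSum-map-cong : ∀ {B : Set} {f g : B → A} (xs : List B) → (∀ {x} → x ∈ xs → f x ≈ g x) → listSum (map f xs) ≈ listSum (map g xs)
  listSum-map-cong []       f≈g = ≈-refl
  listSum-map-cong (x ∷ xs) f≈g = +-cong (f≈g (here refl)) (listSum-map-cong xs (f≈g ∘ there))

  listSum-map-*ˡ : ∀ {B : Set} (k : A) (f : B → A) xs → listSum (map (λ x → k ⊗ f x) xs) ≈ k ⊗ listSum (map f xs)
  listSum-map-*ˡ k f []       = ≈-sym (zeroʳ k)
  listSum-map-*ˡ k f (x ∷ xs) = ≈-trans (+-congˡ (listSum-map-*ˡ k f xs)) (≈-sym (distribˡ k (f x) (listSum (map f xs))))

  listSum-map-concatMap : ∀ {B C : Set} (w : C → A) (g : B → List C) xs →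
    listSum (map w (concatMap g xs)) ≈ listSum (map (λ x → listSum (map w (g x))) xs)
  listSum-map-concatMap w g []       = ≈-refl
  listSum-map-concatMap w g (x ∷ xs) = begin
    listSum (map w (g x ++ concatMap g xs))                 ≡⟨ cong listSum (ListP.map-++ w (g x) (concatMap g xs)) ⟩
    listSum (map w (g x) ++ map w (concatMap g xs))         ≈⟨ listSum-++ (map w (g x)) (map w (concatMap g xs)) ⟩
    listSum (map w (g x)) ⊕ listSum (map w (concatMap g xs))      ≈⟨ +-congˡ (listSum-map-concatMap w g xs) ⟩
    listSum (map w (g x)) ⊕ listSum (map (λ x → listSum (map w (g x))) xs) ∎

  listSum-map-filter : ∀ {B : Set} (p : B → Bool) (f : B → A) xs →
    listSum (map f (filter (λ x → p x ≟ᵇ true) xs)) ≈ listSum (map (λ x → if p x then f x else 0#) xs)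
  listSum-map-filter p f []       = ≈-refl
  listSum-map-filter p f (x ∷ xs) with p x
  ... | true  = +-congˡ (listSum-map-filter p f xs)
  ... | false = ≈-trans (listSum-map-filter p f xs) (≈-sym (+-identityˡ _))

  listSum-↭ : ∀ {xs ys} → xs ↭ ys → listSum xs ≈ listSum ys
  listSum-↭ xs↭ys = PermutationSetoidP.foldr-commMonoid setoid +-isCommutativeMonoid (↭.↭⇒↭ₛ′ isEquivalence xs↭ys)

  [_]q : ℕ → A
  [ zero  ]q = 0#
  [ suc m ]q = 1# ⊕ q ⊗ [ m ]q

  [+]q : ∀ m k → [ m + k ]q ≈ [ m ]q ⊕ q^ m ⊗ [ k ]q
  [+]q zero    k = ≈-sym (≈-trans (+-identityˡ _) (*-identityˡ _))
  [+]q (suc m) k = begin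
    1# ⊕ q ⊗ [ m + k ]q                      ≈⟨ +-congˡ (*-congˡ ([+]q m k)) ⟩
    1# ⊕ q ⊗ ([ m ]q ⊕ q^ m ⊗ [ k ]q)       ≈⟨ distribute q [ m ]q (q^ m) [ k ]q ⟩
    (1# ⊕ q ⊗ [ m ]q) ⊕ (q ⊗ q^ m) ⊗ [ k ]q ∎
    where
    distribute : ∀ q x p y → 1# ⊕ q ⊗ (x ⊕ p ⊗ y) ≈ (1# ⊕ q ⊗ x) ⊕ (q ⊗ p) ⊗ y
    distribute = solve 4 (λ q x p y → con 1 :+ q :* (x :+ p :* y) := (con 1 :+ q :* x) :+ (q :* p) :* y) ≈-refl

  [suc]q : ∀ m → [ suc m ]q ≈ [ m ]q ⊕ q^ m
  [suc]q m = begin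
    [ suc m ]q                  ≡⟨ cong [_]q (ℕP.+-comm 1 m) ⟩
    [ m + 1 ]q                  ≈⟨ [+]q m 1 ⟩
    [ m ]q ⊕ q^ m ⊗ [ 1 ]q     ≈⟨ +-congˡ (≈-trans (*-congˡ (≈-trans (+-congˡ (zeroʳ q)) (+-identityʳ 1#))) (*-identityʳ _)) ⟩
    [ m ]q ⊕ q^ m              ∎

  qInt≈[]q : ∀ m → qInt R q m ≈ [ m ]q
  qInt≈[]q zero    = ≈-refl
  qInt≈[]q (suc m) = begin
    listSum (map q^ (List.upTo (suc m)))             ≡⟨ cong (listSum ∘ map q^) (sym (ListP.upTo-∷ʳ m)) ⟩
    listSum (map q^ (List.upTo m List.∷ʳ m))         ≡⟨ cong listSum (ListP.map-++ q^ (List.upTo m) [ m ]) ⟩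
    listSum (map q^ (List.upTo m) ++ [ q^ m ])      ≈⟨ listSum-++ (map q^ (List.upTo m)) [ q^ m ] ⟩
    qInt R q m ⊕ (q^ m ⊕ 0#)                      ≈⟨ +-cong (qInt≈[]q m) (+-identityʳ (q^ m)) ⟩
    [ m ]q ⊕ q^ m                                 ≈⟨ ≈-sym ([suc]q m) ⟩
    [ suc m ]q                                     ∎

  ∑-q^openAbove : ∀ n (p : Fin n → Bool) → ∑ᴿ.sum (λ a → if p a then q^ (card n (λ w → a <ᶠ w ∧ p w)) else 0#) ≈ [ card n p ]q
  ∑-q^openAbove zero    p = ≈-refl
  ∑-q^openAbove (suc n) p = ≈-trans (+-congˡ (∑-q^openAbove n (p ∘ Fin.suc))) (first (p Fin.zero))
    where
    m = card n (p ∘ Fin.suc)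
    first : ∀ b → (if b then q^ m else 0#) ⊕ [ m ]q ≈ [ indicator b + m ]q
    first false = +-identityˡ [ m ]q
    first true  = ≈-trans (+-comm (q^ m) [ m ]q) (≈-sym ([suc]q m))

  weight : ∀ {n} → Weighted n → A
  weight x = q^ (proj₂ x)

  listSum-closings : ∀ {n} (x : Weighted n) → listSum (map weight (closings x)) ≈ q^ (proj₂ x) ⊗ [ openCount (lookup (proj₁ x)) ]q
  listSum-closings {n} (v , e) = begin
    listSum (map weight (map closing (openVertices P)))                 ≡⟨ cong listSum (sym (ListP.map-∘ (openVertices P))) ⟩
    listSum (map (λ a → q^ (e + openAbove P a)) (openVertices P))       ≈⟨ listSum-map-cong (openVertices P) (λ {a} _ → ^-homo-* q e (openAbove P a)) ⟩
    listSum (map (λ a → q^ e ⊗ q^ (openAbove P a)) (openVertices P))    ≈⟨ listSum-map-*ˡ (q^ e) (q^ ∘ openAbove P) (openVertices P) ⟩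
    q^ e ⊗ listSum (map (q^ ∘ openAbove P) (openVertices P))           ≈⟨ *-congˡ (listSum-map-filter (isOpen P) (q^ ∘ openAbove P) (allFin n)) ⟩
    q^ e ⊗ listSum (map atOpen (allFin n))                              ≡⟨ cong (q^ e ⊗_) (foldr-map-allFin +-monoid n atOpen) ⟩
    q^ e ⊗ ∑ᴿ.sum atOpen                                          ≈⟨ *-congˡ (∑-q^openAbove n (isOpen P)) ⟩
    q^ e ⊗ [ openCount P ]q                                       ∎
    where
    P = lookup v
    closing : Fin n → Weighted (suc n)
    closing a = closeVec v a , e + openAbove P a
    atOpen : Fin n → A
    atOpen a = if isOpen P a then q^ (openAbove P a) else 0#

  historySum : ℕ → ℕ → ℕ → A
  historySum n h c = listSum (map weight (histories n h c))

  listSum-opened : ∀ n h c → listSum (map weight (openedHistories n (suc h) c)) ≈ q^ (c + c) ⊗ historySum n h c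
  listSum-opened n h c = begin
    listSum (map weight (map (opening c) (histories n h c)))            ≡⟨ cong listSum (sym (ListP.map-∘ (histories n h c))) ⟩
    listSum (map (λ x → q^ ((c + c) + proj₂ x)) (histories n h c))      ≈⟨ listSum-map-cong (histories n h c) (λ {x} _ → ^-homo-* q (c + c) (proj₂ x)) ⟩
    listSum (map (λ x → q^ (c + c) ⊗ weight x) (histories n h c))       ≈⟨ listSum-map-*ˡ (q^ (c + c)) weight (histories n h c) ⟩
    q^ (c + c) ⊗ historySum n h c                                 ∎

  listSum-closed : ∀ n h c → listSum (map weight (closedHistories n h (suc c))) ≈ [ suc h ]q ⊗ historySum n (suc h) c
  listSum-closed n h c = begin
    listSum (map weight (concatMap closings xs))                  ≈⟨ listSum-map-concatMap weight closings xs ⟩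
    listSum (map (λ x → listSum (map weight (closings x))) xs)          ≈⟨ listSum-map-cong xs each ⟩
    listSum (map (λ x → [ suc h ]q ⊗ weight x) xs)                ≈⟨ listSum-map-*ˡ [ suc h ]q weight xs ⟩
    [ suc h ]q ⊗ historySum n (suc h) c                     ∎
    where
    xs = histories n (suc h) c
    each : ∀ {x} → x ∈ xs → listSum (map weight (closings x)) ≈ [ suc h ]q ⊗ weight x
    each {x} x∈ = ≈-trans (listSum-closings x)
      (≈-trans (*-congˡ (≈-reflexive (cong [_]q (Valid.openCount≡ (histories-valid n (suc h) c x∈))))) (*-comm _ _))

  [_]q! : ℕ → A
  [ zero  ]q! = 1#
  [ suc h ]q! = [ h ]q! ⊗ [ suc h ]q

  qOddFactorial : ℕ → A
  qOddFactorial zero    = 1#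
  qOddFactorial (suc c) = qOddFactorial c ⊗ [ suc (c + c) ]q

  qRising : ℕ → ℕ → A
  qRising m zero    = 1#
  qRising m (suc h) = qRising m h ⊗ [ m + suc h ]q

  qRising-shift : ∀ m h → qRising m (suc (suc h)) ≈ ([ suc m ]q ⊗ [ suc (suc m) ]q) ⊗ qRising (suc (suc m)) h
  qRising-shift m zero    = begin
    (1# ⊗ [ m + 1 ]q) ⊗ [ m + 2 ]q               ≈⟨ *-congʳ (*-identityˡ _) ⟩
    [ m + 1 ]q ⊗ [ m + 2 ]q                      ≡⟨ cong₂ (λ x y → [ x ]q ⊗ [ y ]q) (ℕP.+-comm m 1) (ℕP.+-comm m 2) ⟩
    [ suc m ]q ⊗ [ suc (suc m) ]q                ≈⟨ ≈-sym (*-identityʳ _) ⟩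
    ([ suc m ]q ⊗ [ suc (suc m) ]q) ⊗ 1#         ∎
  qRising-shift m (suc h) = begin
    qRising m (suc (suc h)) ⊗ [ m + suc (suc (suc h)) ]q   ≈⟨ *-congʳ (qRising-shift m h) ⟩
    (X ⊗ qRising (suc (suc m)) h) ⊗ [ m + suc (suc (suc h)) ]q
                                                           ≡⟨ cong (λ k → (X ⊗ qRising (suc (suc m)) h) ⊗ [ k ]q) (ℕP.+-suc m (suc (suc h))) ⟩
    (X ⊗ qRising (suc (suc m)) h) ⊗ [ suc (m + suc (suc h)) ]q
                                                           ≡⟨ cong (λ k → (X ⊗ qRising (suc (suc m)) h) ⊗ [ suc k ]q) (ℕP.+-suc m (suc h)) ⟩
    (X ⊗ qRising (suc (suc m)) h) ⊗ [ suc (suc m) + suc h ]q  ≈⟨ *-assoc X _ _ ⟩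
    X ⊗ qRising (suc (suc m)) (suc h)                      ∎
    where
    X = [ suc m ]q ⊗ [ suc (suc m) ]q

  opened-closedForm : ∀ n h c {X} → historySum n h c ⊗ [ h ]q! ≈ X →
    listSum (map weight (openedHistories n (suc h) c)) ⊗ [ suc h ]q! ≈ q^ (c + c) ⊗ X ⊗ [ suc h ]q
  opened-closedForm n h c {X} ih = begin
    listSum (map weight (openedHistories n (suc h) c)) ⊗ ([ h ]q! ⊗ [ suc h ]q) ≈⟨ *-congʳ (listSum-opened n h c) ⟩
    (Q ⊗ historySum n h c) ⊗ ([ h ]q! ⊗ [ suc h ]q)                       ≈⟨ regroup Q (historySum n h c) [ h ]q! [ suc h ]q ⟩
    Q ⊗ (historySum n h c ⊗ [ h ]q!) ⊗ [ suc h ]q                         ≈⟨ *-congʳ (*-congˡ ih) ⟩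
    Q ⊗ X ⊗ [ suc h ]q                                                    ∎
    where
    Q = q^ (c + c)
    regroup : ∀ a g f i → (a ⊗ g) ⊗ (f ⊗ i) ≈ a ⊗ (g ⊗ f) ⊗ i
    regroup = solve 4 (λ a g f i → (a :* g) :* (f :* i) := a :* (g :* f) :* i) ≈-refl

  closed-closedForm : ∀ n h c {Y} → historySum n (suc h) c ⊗ [ suc h ]q! ≈ Y →
    listSum (map weight (closedHistories n h (suc c))) ⊗ [ h ]q! ≈ Y
  closed-closedForm n h c {Y} ih = begin
    listSum (map weight (closedHistories n h (suc c))) ⊗ [ h ]q!   ≈⟨ *-congʳ (listSum-closed n h c) ⟩
    ([ suc h ]q ⊗ historySum n (suc h) c) ⊗ [ h ]q!          ≈⟨ regroup [ suc h ]q (historySum n (suc h) c) [ h ]q! ⟩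
    historySum n (suc h) c ⊗ [ suc h ]q!                     ≈⟨ ih ⟩
    Y                                                        ∎
    where
    regroup : ∀ i g f → (i ⊗ g) ⊗ f ≈ g ⊗ (f ⊗ i)
    regroup = solve 3 (λ i g f → (i :* g) :* f := g :* (f :* i)) ≈-refl

  openedTerm : ℕ → ℕ → A
  openedTerm zero    c = 0#
  openedTerm (suc h) c = q^ (c + c) ⊗ (qOddFactorial c ⊗ qRising (c + c) h) ⊗ [ suc h ]q

  closedTerm : ℕ → ℕ → A
  closedTerm h zero    = 0#
  closedTerm h (suc c) = qOddFactorial c ⊗ qRising (c + c) (suc h)

  closedForm-recurrence : ∀ {n} h c → suc n ≡ c + c + h → openedTerm h c ⊕ closedTerm h c ≈ qOddFactorial c ⊗ qRising (c + c) h
  closedForm-recurrence zero    zero    ()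
  closedForm-recurrence (suc h) zero    _ = tidy (qRising 0 h) [ suc h ]q
    where
    tidy : ∀ r i → 1# ⊗ (1# ⊗ r) ⊗ i ⊕ 0# ≈ 1# ⊗ (r ⊗ i)
    tidy = solve 2 (λ r i → con 1 :* (con 1 :* r) :* i :+ con 0 := con 1 :* (r :* i)) ≈-refl
  closedForm-recurrence zero    (suc c) _ = begin
    0# ⊕ qOddFactorial c ⊗ (1# ⊗ [ c + c + 1 ]q)     ≡⟨ cong (λ k → 0# ⊕ qOddFactorial c ⊗ (1# ⊗ [ k ]q)) (ℕP.+-comm (c + c) 1) ⟩
    0# ⊕ qOddFactorial c ⊗ (1# ⊗ [ suc (c + c) ]q)   ≈⟨ tidy (qOddFactorial c) [ suc (c + c) ]q ⟩
    qOddFactorial (suc c) ⊗ 1#                      ∎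
    where
    tidy : ∀ d i → 0# ⊕ d ⊗ (1# ⊗ i) ≈ (d ⊗ i) ⊗ 1#
    tidy = solve 2 (λ d i → con 0 :+ d :* (con 1 :* i) := (d :* i) :* con 1) ≈-refl
  closedForm-recurrence (suc h) (suc c) _ = begin
    q^ (suc c + suc c) ⊗ (qOddFactorial (suc c) ⊗ qRising (suc c + suc c) h) ⊗ [ suc h ]q ⊕ D ⊗ qRising m (suc (suc h))
      ≡⟨ cong (λ k → q^ k ⊗ (qOddFactorial (suc c) ⊗ qRising k h) ⊗ [ suc h ]q ⊕ D ⊗ qRising m (suc (suc h))) M≡ ⟩
    q^ M ⊗ ((D ⊗ [ suc m ]q) ⊗ qRising M h) ⊗ [ suc h ]q ⊕ D ⊗ qRising m (suc (suc h))
      ≈⟨ +-congˡ (*-congˡ (qRising-shift m h)) ⟩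
    q^ M ⊗ ((D ⊗ [ suc m ]q) ⊗ qRising M h) ⊗ [ suc h ]q ⊕ D ⊗ (([ suc m ]q ⊗ [ M ]q) ⊗ qRising M h)
      ≈⟨ factor (q^ M) D [ suc m ]q (qRising M h) [ suc h ]q [ M ]q ⟩
    ((D ⊗ [ suc m ]q) ⊗ qRising M h) ⊗ ([ M ]q ⊕ q^ M ⊗ [ suc h ]q)
      ≈⟨ *-congˡ (≈-sym ([+]q M (suc h))) ⟩
    ((D ⊗ [ suc m ]q) ⊗ qRising M h) ⊗ [ M + suc h ]q
      ≈⟨ *-assoc (D ⊗ [ suc m ]q) (qRising M h) [ M + suc h ]q ⟩
    (D ⊗ [ suc m ]q) ⊗ qRising M (suc h)
      ≡⟨ cong (λ k → qOddFactorial (suc c) ⊗ qRising k (suc h)) (sym M≡) ⟩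
    qOddFactorial (suc c) ⊗ qRising (suc c + suc c) (suc h) ∎
    where
    D = qOddFactorial c
    m = c + c
    M = suc (suc m)
    M≡ : suc c + suc c ≡ M
    M≡ = cong suc (ℕP.+-suc c c)
    factor : ∀ p d x r i y → p ⊗ ((d ⊗ x) ⊗ r) ⊗ i ⊕ d ⊗ ((x ⊗ y) ⊗ r) ≈ ((d ⊗ x) ⊗ r) ⊗ (y ⊕ p ⊗ i)
    factor = solve 6 (λ p d x r i y → p :* ((d :* x) :* r) :* i :+ d :* ((x :* y) :* r) := ((d :* x) :* r) :* (y :+ p :* i)) ≈-refl

  historySum-closedForm : ∀ n h c → n ≡ c + c + h → historySum n h c ⊗ [ h ]q! ≈ qOddFactorial c ⊗ qRising (c + c) h
  historySum-closedForm zero    zero    zero    _  = *-congʳ (+-identityʳ 1#)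
  historySum-closedForm zero    (suc h) zero    ()
  historySum-closedForm zero    (suc h) (suc c) ()
  historySum-closedForm zero    zero    (suc c) ()
  historySum-closedForm (suc n) h       c       n≡ = begin
    listSum (map weight (openedHistories n h c ++ closedHistories n h c)) ⊗ [ h ]q!
      ≈⟨ *-congʳ (≈-trans (≈-reflexive (cong listSum (ListP.map-++ weight (openedHistories n h c) (closedHistories n h c))))
                          (listSum-++ (map weight (openedHistories n h c)) _)) ⟩
    (listSum (map weight (openedHistories n h c)) ⊕ listSum (map weight (closedHistories n h c))) ⊗ [ h ]q!
      ≈⟨ distribʳ [ h ]q! _ _ ⟩
    listSum (map weight (openedHistories n h c)) ⊗ [ h ]q! ⊕ listSum (map weight (closedHistories n h c)) ⊗ [ h ]q!
      ≈⟨ +-cong (opened h c n≡) (closed h c n≡) ⟩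
    openedTerm h c ⊕ closedTerm h c
      ≈⟨ closedForm-recurrence h c n≡ ⟩
    qOddFactorial c ⊗ qRising (c + c) h ∎
    where
    opened : ∀ h c → suc n ≡ c + c + h → listSum (map weight (openedHistories n h c)) ⊗ [ h ]q! ≈ openedTerm h c
    opened zero    c _  = zeroˡ 1#
    opened (suc h) c n≡ = opened-closedForm n h c (historySum-closedForm n h c (ℕP.suc-injective (trans n≡ (ℕP.+-suc (c + c) h))))
    closed : ∀ h c → suc n ≡ c + c + h → listSum (map weight (closedHistories n h c)) ⊗ [ h ]q! ≈ closedTerm h c
    closed h zero    _  = zeroˡ [ h ]q!
    closed h (suc c) n≡ = closed-closedForm n h c (historySum-closedForm n (suc h) c (trans (ℕP.suc-injective n≡) (shift c h)))
      where
      shift : ∀ c h → c + suc c + h ≡ c + c + suc h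
      shift = solve-∀

  Π : List A → A
  Π = prodR R

  Π-∷ʳ : ∀ xs y → Π (xs List.∷ʳ y) ≈ Π xs ⊗ y
  Π-∷ʳ []       y = ≈-trans (*-identityʳ y) (≈-sym (*-identityˡ y))
  Π-∷ʳ (x ∷ xs) y = ≈-trans (*-congˡ (Π-∷ʳ xs y)) (≈-sym (*-assoc x (Π xs) y))

  qOddFactorial≈qDoubleFact : ∀ n → qOddFactorial n ≈ qDoubleFact R q n
  qOddFactorial≈qDoubleFact zero    = ≈-refl
  qOddFactorial≈qDoubleFact (suc n) = begin
    qOddFactorial n ⊗ [ suc (n + n) ]q
      ≈⟨ *-cong (qOddFactorial≈qDoubleFact n) (≈-sym (≈-trans (qInt≈[]q (2 * suc n ∸ 1)) (≈-reflexive (cong [_]q (odd n))))) ⟩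
    qDoubleFact R q n ⊗ g n                         ≈⟨ ≈-sym (Π-∷ʳ (map g (List.upTo n)) (g n)) ⟩
    Π (map g (List.upTo n) List.∷ʳ g n)            ≡⟨ cong Π (sym (ListP.map-++ g (List.upTo n) [ n ])) ⟩
    Π (map g (List.upTo n List.∷ʳ n))              ≡⟨ cong (Π ∘ map g) (ListP.upTo-∷ʳ n) ⟩
    qDoubleFact R q (suc n)                         ∎
    where
    g : ℕ → A
    g i = qInt R q (2 * suc i ∸ 1)
    odd : ∀ n → n + suc (n + 0) ≡ suc (n + n)
    odd = solve-∀

  q^t-factor : ∀ n {x} → x ∈ histories (2 * n) 0 n → q^ (t n (proj₁ x)) ≈ q^ (suc n C 2) ⊗ weight x
  q^t-factor n {v , e} x∈ = ≈-trans (≈-reflexive (cong q^ (t≡C2+exponent n v (histories-valid (2 * n) 0 n x∈)))) (^-homo-* q (suc n C 2) e)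

  historySum≈qDoubleFact : ∀ n → historySum (2 * n) 0 n ≈ qDoubleFact R q n
  historySum≈qDoubleFact n = begin
    historySum (2 * n) 0 n                 ≈⟨ ≈-sym (*-identityʳ _) ⟩
    historySum (2 * n) 0 n ⊗ 1#            ≈⟨ historySum-closedForm (2 * n) 0 n (2n≡n+n+0 n) ⟩
    qOddFactorial n ⊗ 1#                   ≈⟨ *-identityʳ _ ⟩
    qOddFactorial n                        ≈⟨ qOddFactorial≈qDoubleFact n ⟩
    qDoubleFact R q n                      ∎
    where
    2n≡n+n+0 : ∀ n → 2 * n ≡ n + n + 0
    2n≡n+n+0 = solve-∀

mainTheorem1 : {c ℓ : Level} (R : CommutativeSemiring c ℓ) (q : CommutativeSemiring.Carrier R) (n : ℕ) → n ≥ 1 →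
    CommutativeSemiring._≈_ R (depthGF R q n)
      (CommutativeSemiring._*_ R (_^_ (CommutativeSemiring.rawSemiring R) q (suc n C 2)) (qDoubleFact R q n))
mainTheorem1 R q n _ = begin
  listSum (map (q^ ∘ t n) (PM n))                     ≈⟨ listSum-↭ (↭P.map⁺ (q^ ∘ t n) (↭.↭-sym (PM-↭ n))) ⟩
  listSum (map (q^ ∘ t n) (map proj₁ E))              ≡⟨ cong listSum (sym (ListP.map-∘ E)) ⟩
  listSum (map (q^ ∘ t n ∘ proj₁) E)                  ≈⟨ listSum-map-cong E (q^t-factor n) ⟩
  listSum (map (λ x → q^ (suc n C 2) ⊗ weight x) E)   ≈⟨ listSum-map-*ˡ (q^ (suc n C 2)) weight E ⟩
  q^ (suc n C 2) ⊗ historySum (2 * n) 0 n             ≈⟨ *-congˡ (historySum≈qDoubleFact n) ⟩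
  q^ (suc n C 2) ⊗ qDoubleFact R q n                  ∎
  where
  open GeneratingFunction R q
  open CommutativeSemiring R using (*-congˡ) renaming (_*_ to _⊗_)
  open import Relation.Binary.Reasoning.Setoid (CommutativeSemiring.setoid R)
  E = histories (2 * n) 0 n
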